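{- Let $(h,\ast,1)$ be a connected associative presheaf, with induced product $\cdot$ on $\mathcal G(h)$, and let $a\in\mathcal G(h)$. If $a=x_1\cdots x_l=s_1\cdots s_t$ are two factorizations of $a$ into irreducible coinvariants, then the multisets $\{x_1,\dots,x_l\}$ and $\{s_1,\dots,s_t\}$ coincide.
   Context: A combinatorial presheaf $h$ is a contravariant functor from finite sets with injections to finite sets; $h[I]$ are objects on $I$, $a|_J$ restriction. Objects are isomorphic if related by a relabeling bijection; $\mathcal G(h)=\biguplus_n h[[n]]/\sim$. An associative presheaf $(h,\ast,1)$ has products $h[I]\times h[J]\to h[I\sqcup J]$ for disjoint $I,J$, natural in relabelings, with $(a\ast b)|_{A\sqcup B}=a|_A\ast b|_B$, associative, unit $1\in h[\emptyset]$; connected if $|h[\emptyset]|=1$. The product on $\mathcal G(h)$: for $a\in h[[n_1]],b\in h[[n_2]]$, $\bar a\cdot\bar b$ is the class of $a\ast b'$ with $b'$ the order-preserving relabeling of $b$ to $\{n_1+1,\dots,n_1+n_2\}$. A coinvariant $t\ne1$ is irreducible if $t=a\cdot b$ implies $a=1$ or $b=1$. -}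

module Defs where

open import Data.Nat using (ℕ; zero; suc; _+_)
open import Data.Nat.Properties using (+-assoc; +-identityʳ)
open import Data.Fin using (Fin; _↑ˡ_; _↑ʳ_; splitAt)
open import Data.Sum using (_⊎_; inj₁; inj₂; [_,_]′)
open import Data.Product using (Σ; ∃; _×_; _,_; proj₁; proj₂)
open import Data.List using (List; []; _∷_; foldr)
open import Data.List.Relation.Unary.All using (All)
open import Data.List.Relation.Binary.Permutation.Homogeneous using (Permutation)
open import Function.Bundles using (_↣_; _↔_; Injection)
open import Relation.Binary.PropositionalEquality using (_≡_; subst)
open import Relation.Nullary using (¬_)

-- Finite sets are represented by their skeleton Fin n (the canonical n-element set [n]).
-- An injection Fin m ↣ Fin n is a morphism of the category of finite sets with injections.

to : ∀ {m n} → Fin m ↣ Fin n → Fin m → Fin n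
to = Injection.to

_⊕_ : ∀ {p q m n} → (Fin p → Fin m) → (Fin q → Fin n) → Fin (p + q) → Fin (m + n)
_⊕_ {p} {q} {m} {n} f g i = [ (λ x → f x ↑ˡ n) , (λ y → m ↑ʳ g y) ]′ (splitAt p i)

record Presheaf : Set₁ where
  field
    H      : ℕ → Set
    finite : ∀ n → Σ ℕ (λ k → H n ↔ Fin k)
    res    : ∀ {m n} → Fin m ↣ Fin n → H n → H m
    res-cong : ∀ {m n} (f g : Fin m ↣ Fin n) → (∀ i → to f i ≡ to g i) →
               ∀ a → res f a ≡ res g a
    res-id   : ∀ {n} (f : Fin n ↣ Fin n) → (∀ i → to f i ≡ i) → ∀ a → res f a ≡ a
    res-∘    : ∀ {m n p} (f : Fin m ↣ Fin n) (g : Fin n ↣ Fin p) (k : Fin m ↣ Fin p) →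
               (∀ i → to k i ≡ to g (to f i)) → ∀ a → res k a ≡ res f (res g a)

record AssocPresheaf : Set₁ where
  field
    presheaf : Presheaf
  open Presheaf presheaf public
  field
    _∗_  : ∀ {m n} → H m → H n → H (m + n)
    one  : H zero
    -- (a ∗ b)|_{A ⊔ B} = a|_A ∗ b|_B  (for arbitrary injections; this contains
    -- naturality with respect to relabelings as the bijective case)
    res-∗ : ∀ {p q m n} (f : Fin p ↣ Fin m) (g : Fin q ↣ Fin n) (k : Fin (p + q) ↣ Fin (m + n)) →
            (∀ i → to k i ≡ (to f ⊕ to g) i) →
            ∀ a b → res k (a ∗ b) ≡ res f a ∗ res g b
    ∗-assoc : ∀ {m n p} (a : H m) (b : H n) (c : H p) →
              subst H (+-assoc m n p) ((a ∗ b) ∗ c) ≡ a ∗ (b ∗ c)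
    ∗-unitˡ : ∀ {n} (a : H n) → one ∗ a ≡ a
    ∗-unitʳ : ∀ {n} (a : H n) → subst H (+-identityʳ n) (a ∗ one) ≡ a

Connected : AssocPresheaf → Set
Connected h = ∀ (x : H zero) → x ≡ one
  where open AssocPresheaf h

module Coinvariants (h : AssocPresheaf) where
  open AssocPresheaf h

  Obj : Set
  Obj = Σ ℕ H

  _≃_ : Obj → Obj → Set
  (m , a) ≃ (n , b) = Σ (Fin n ↣ Fin m) λ σ →
                        (∀ j → ∃ λ i → to σ i ≡ j) × (res σ a ≡ b)

  -- product on coinvariants, on representatives: b is shifted order-preservingly
  -- to {m+1,…,m+n}, which in the skeleton is the second summand of Fin (m + n)
  _·_ : Obj → Obj → Obj
  (m , a) · (n , b) = (m + n , a ∗ b)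

  𝟙 : Obj
  𝟙 = (zero , one)

  prod : List Obj → Obj
  prod = foldr _·_ 𝟙

  Irreducible : Obj → Set
  Irreducible t = ¬ (t ≃ 𝟙) ×
                  (∀ a b → t ≃ (a · b) → (a ≃ 𝟙) ⊎ (b ≃ 𝟙))

  SameMultiset : List Obj → List Obj → Set
  SameMultiset = Permutation _≃_

-- Both factorisations are related by a relabelling τ of the ground set, and each factor of a
-- product occupies a block of positions. Restricting a product to a set of positions gives the
-- product of its restrictions to the two sides, so, by connectedness, an irreducible object sitting
-- on some positions of a product sits inside a single block. Applying this to τ and to τ⁻¹ shows
-- that τ maps the block of x₁ exactly onto the block of some sⱼ; hence x₁ ≃ sⱼ, and τ also matches
-- the complementary positions, giving x₂ ⋯ xₗ ≃ the product of the remaining sᵢ.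

module Submission where

open import Defs
open import Data.Nat using (ℕ; zero; suc; _+_)
open import Data.Nat.Properties using (+-identityʳ)
open import Data.Fin using (Fin; zero; suc; _↑ˡ_; _↑ʳ_; splitAt; toℕ; cast; lift)
open import Data.Fin.Properties
  using (splitAt-↑ˡ; splitAt-↑ʳ; splitAt⁻¹-↑ˡ; splitAt⁻¹-↑ʳ; ↑ˡ-injective; ↑ʳ-injective;
         suc-injective; lift-injective; toℕ-cast; toℕ-↑ˡ; toℕ-injective; any?; _≟_)
open import Data.Sum using (_⊎_; inj₁; inj₂; [_,_]′)
open import Data.Product using (Σ; ∃; _×_; _,_; proj₁; proj₂; swap; map₂)
open import Data.Empty using (⊥-elim)
open import Data.List using (List; []; _∷_; length; lookup; removeAt)
open import Data.List.Relation.Unary.All as All using (All; []; _∷_)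
open import Data.List.Membership.Propositional.Properties using (∈-lookup)
open import Function.Base using (_∘_)
open import Function.Bundles using (_↣_; Injection; mk↣)
open import Function.Construct.Identity using (↣-id)
open import Function.Construct.Composition using (_↣-∘_)
open import Relation.Binary.PropositionalEquality
open import Relation.Nullary using (¬_; yes; no)
open import Relation.Unary using (Decidable)
open import Relation.Binary.Bundles using (Setoid)
import Relation.Binary.Reasoning.Setoid as SetoidReasoning
import Data.List.Relation.Binary.Permutation.Setoid as Permutation

private variable
  a b k l m n p q : ℕ

injective : (f : Fin m ↣ Fin n) → ∀ {i j} → to f i ≡ to f j → i ≡ j
injective = Injection.injective

Image : Fin k ↣ Fin n → Fin n → Set
Image e i = ∃ λ j → to e j ≡ i

Onto : Fin k ↣ Fin n → Set
Onto e = ∀ i → Image e i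

record _⊆_ (e : Fin k ↣ Fin n) (e′ : Fin l ↣ Fin n) : Set where
  constructor mk⊆
  field ⊆-at : ∀ j → Image e′ (to e j)
open _⊆_

SameImage : Fin k ↣ Fin n → Fin l ↣ Fin n → Set
SameImage e e′ = e ⊆ e′ × e′ ⊆ e

⊆-trans : {e : Fin k ↣ Fin n} {e′ : Fin l ↣ Fin n} {e″ : Fin m ↣ Fin n} →
          e ⊆ e′ → e′ ⊆ e″ → e ⊆ e″
⊆-trans e⊆e′ e′⊆e″ .⊆-at j with ⊆-at e⊆e′ j
... | i , eq with ⊆-at e′⊆e″ i
... | i′ , eq′ = i′ , trans eq′ eq

∘-monoʳ-⊆ : (φ : Fin m ↣ Fin n) {e : Fin k ↣ Fin m} {e′ : Fin l ↣ Fin m} →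
            e ⊆ e′ → (φ ↣-∘ e) ⊆ (φ ↣-∘ e′)
∘-monoʳ-⊆ φ e⊆e′ .⊆-at j with ⊆-at e⊆e′ j
... | i , eq = i , cong (to φ) eq

∘-onto : (σ : Fin m ↣ Fin n) (τ : Fin k ↣ Fin m) → Onto σ → Onto τ → Onto (σ ↣-∘ τ)
∘-onto σ τ σ-onto τ-onto i with σ-onto i
... | j , σj≡i with τ-onto j
... | l , τl≡j = l , trans (cong (to σ) τl≡j) σj≡i

inverse : (σ : Fin m ↣ Fin n) → Onto σ → Fin n ↣ Fin m
inverse σ onto = mk↣ {to = proj₁ ∘ onto}
  (λ {i} {j} eq → trans (sym (proj₂ (onto i))) (trans (cong (to σ) eq) (proj₂ (onto j))))

inverseʳ : (σ : Fin m ↣ Fin n) (onto : Onto σ) → ∀ i → to σ (to (inverse σ onto) i) ≡ i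
inverseʳ σ onto i = proj₂ (onto i)

inverseˡ : (σ : Fin m ↣ Fin n) (onto : Onto σ) → ∀ i → to (inverse σ onto) (to σ i) ≡ i
inverseˡ σ onto i = injective σ (inverseʳ σ onto (to σ i))

inverse-⊆ : (τ : Fin m ↣ Fin n) (onto : Onto τ) {A : Fin a ↣ Fin m} {B : Fin b ↣ Fin n} →
            (inverse τ onto ↣-∘ B) ⊆ A → B ⊆ (τ ↣-∘ A)
inverse-⊆ τ onto {B = B} τ⁻¹B⊆A .⊆-at j with ⊆-at τ⁻¹B⊆A j
... | i , Ai≡τ⁻¹Bj = i , trans (cong (to τ) Ai≡τ⁻¹Bj) (inverseʳ τ onto (to B j))

⊆-via-inverse : (τ : Fin m ↣ Fin n) (onto : Onto τ)
                {A : Fin a ↣ Fin m} {B : Fin b ↣ Fin n} {C : Fin k ↣ Fin m} →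
                (τ ↣-∘ A) ⊆ B → (inverse τ onto ↣-∘ B) ⊆ C → A ⊆ C
⊆-via-inverse τ onto {A} τA⊆B τ⁻¹B⊆C .⊆-at j with ⊆-at τA⊆B j
... | i , Bi≡τAj with ⊆-at τ⁻¹B⊆C i
... | l , Cl≡τ⁻¹Bi = l , trans Cl≡τ⁻¹Bi (trans (cong (to (inverse τ onto)) Bi≡τAj) (inverseˡ τ onto (to A j)))

empty-↣ : Fin 0 ↣ Fin n
empty-↣ = mk↣ {to = λ ()} (λ { {()} })

↑ˡ-↣ : ∀ n → Fin m ↣ Fin (m + n)
↑ˡ-↣ n = mk↣ (↑ˡ-injective n _ _)

↑ʳ-↣ : ∀ m → Fin n ↣ Fin (m + n)
↑ʳ-↣ m = mk↣ (↑ʳ-injective m _ _)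

↑ˡ≢↑ʳ : (i : Fin m) (j : Fin n) → i ↑ˡ n ≢ m ↑ʳ j
↑ˡ≢↑ʳ {m} {n} i j eq with trans (sym (splitAt-↑ˡ m i n)) (trans (cong (splitAt m) eq) (splitAt-↑ʳ m n j))
... | ()

data SplitView (p q : ℕ) : Fin (p + q) → Set where
  inl : (i : Fin p) → SplitView p q (i ↑ˡ q)
  inr : (j : Fin q) → SplitView p q (p ↑ʳ j)

splitView : ∀ p {q} (i : Fin (p + q)) → SplitView p q i
splitView p {q} i with splitAt p i in eq
... | inj₁ a = subst (SplitView p q) (splitAt⁻¹-↑ˡ eq) (inl a)
... | inj₂ b = subst (SplitView p q) (splitAt⁻¹-↑ʳ eq) (inr b)

⊕-↑ˡ : (f : Fin p → Fin m) (g : Fin q → Fin n) (i : Fin p) → (f ⊕ g) (i ↑ˡ q) ≡ f i ↑ˡ n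
⊕-↑ˡ {p} {q = q} f g i = cong [ _ , _ ]′ (splitAt-↑ˡ p i q)

⊕-↑ʳ : (f : Fin p → Fin m) (g : Fin q → Fin n) (j : Fin q) → (f ⊕ g) (p ↑ʳ j) ≡ m ↑ʳ g j
⊕-↑ʳ {p} {q = q} f g j = cong [ _ , _ ]′ (splitAt-↑ʳ p q j)

_⊕↣_ : Fin p ↣ Fin m → Fin q ↣ Fin n → Fin (p + q) ↣ Fin (m + n)
_⊕↣_ {p} {m} {q} {n} f g = mk↣ {to = to f ⊕ to g} ⊕-injective
  where
  ⊕-injective : ∀ {x y} → (to f ⊕ to g) x ≡ (to f ⊕ to g) y → x ≡ y
  ⊕-injective {x} {y} eq with splitView p x | splitView p y
  ... | inl i | inl i′ = cong (_↑ˡ q) (injective f (↑ˡ-injective n _ _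
                               (trans (sym (⊕-↑ˡ (to f) (to g) i)) (trans eq (⊕-↑ˡ (to f) (to g) i′)))))
  ... | inl i | inr j′ = ⊥-elim (↑ˡ≢↑ʳ _ _
                               (trans (sym (⊕-↑ˡ (to f) (to g) i)) (trans eq (⊕-↑ʳ (to f) (to g) j′))))
  ... | inr j | inl i′ = ⊥-elim (↑ˡ≢↑ʳ _ _
                               (trans (sym (⊕-↑ˡ (to f) (to g) i′)) (trans (sym eq) (⊕-↑ʳ (to f) (to g) j))))
  ... | inr j | inr j′ = cong (p ↑ʳ_) (injective g (↑ʳ-injective m _ _
                               (trans (sym (⊕-↑ʳ (to f) (to g) j)) (trans eq (⊕-↑ʳ (to f) (to g) j′)))))

All-removeAt : ∀ {A : Set} {P : A → Set} xs j → All P xs → All P (removeAt xs j)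
All-removeAt (x ∷ xs) zero    (_ ∷ pxs)  = pxs
All-removeAt (x ∷ xs) (suc j) (px ∷ pxs) = px ∷ All-removeAt xs j pxs

record Enumeration (P : Fin n → Set) : Set where
  field
    card      : ℕ
    embedding : Fin card ↣ Fin n
    sound     : ∀ j → P (to embedding j)
    complete  : ∀ i → P i → Image embedding i

enumerate : (P : Fin n → Set) → Decidable P → Enumeration P
enumerate {zero} P P? = record { card = 0 ; embedding = empty-↣ ; sound = λ () ; complete = λ () }
enumerate {suc n} P P? with enumerate (P ∘ suc) (P? ∘ suc) | P? zero
... | E | yes P0 = record
  { card      = suc card
  ; embedding = mk↣ (lift-injective (to embedding) (injective embedding) 1)
  ; sound     = λ { zero → P0 ; (suc j) → sound j }
  ; complete  = λ { zero _ → zero , refl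
                  ; (suc i) Pi → let j , eq = complete i Pi in suc j , cong suc eq }
  }
  where open Enumeration E
... | E | no ¬P0 = record
  { card      = card
  ; embedding = mk↣ {to = suc ∘ to embedding} (injective embedding ∘ suc-injective)
  ; sound     = sound
  ; complete  = λ { zero P0 → ⊥-elim (¬P0 P0)
                  ; (suc i) Pi → let j , eq = complete i Pi in j , cong suc eq }
  }
  where open Enumeration E

Image? : (e : Fin k ↣ Fin n) → Decidable (Image e)
Image? e i = any? (λ j → to e j ≟ i)

record ImageSplit (e : Fin k ↣ Fin (p + q)) : Set where
  field
    k₁ k₂     : ℕ
    left      : Fin k₁ ↣ Fin p
    right     : Fin k₂ ↣ Fin q
    sameImage : SameImage e (left ⊕↣ right)

splitImage : (e : Fin k ↣ Fin (p + q)) → ImageSplit e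
splitImage {p = p} {q} e = record
  { left = embedding L ; right = embedding R ; sameImage = e⊆L⊕R , L⊕R⊆e }
  where
  open Enumeration
  L : Enumeration (λ i → Image e (i ↑ˡ q))
  L = enumerate (λ i → Image e (i ↑ˡ q)) (λ i → Image? e _)
  R : Enumeration (λ j → Image e (p ↑ʳ j))
  R = enumerate (λ j → Image e (p ↑ʳ j)) (λ j → Image? e _)
  L⊕R : Fin (card L + card R) ↣ Fin (p + q)
  L⊕R = embedding L ⊕↣ embedding R

  e⊆L⊕R : e ⊆ L⊕R
  e⊆L⊕R .⊆-at j = Image-e⊆Image-L⊕R (to e j) (j , refl)
    where
    Image-e⊆Image-L⊕R : ∀ i → Image e i → Image L⊕R i
    Image-e⊆Image-L⊕R i e∋i with splitView p i
    ... | inl a with complete L a e∋i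
    ... | i′ , refl = i′ ↑ˡ card R , ⊕-↑ˡ (to (embedding L)) (to (embedding R)) i′
    Image-e⊆Image-L⊕R i e∋i | inr b with complete R b e∋i
    ... | i′ , refl = card L ↑ʳ i′ , ⊕-↑ʳ (to (embedding L)) (to (embedding R)) i′

  L⊕R⊆e : L⊕R ⊆ e
  L⊕R⊆e .⊆-at j with splitView (card L) j
  ... | inl i = subst (Image e) (sym (⊕-↑ˡ (to (embedding L)) (to (embedding R)) i)) (sound L i)
  ... | inr i = subst (Image e) (sym (⊕-↑ʳ (to (embedding L)) (to (embedding R)) i)) (sound R i)

record Complementary (A : Fin a ↣ Fin n) (B : Fin b ↣ Fin n) : Set where
  field
    cover    : ∀ i → Image A i ⊎ Image B i
    disjoint : ∀ i j → to A i ≢ to B j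

↑-complementary : Complementary (↑ˡ-↣ {m} n) (↑ʳ-↣ m)
↑-complementary {m} = record { cover = cover ; disjoint = ↑ˡ≢↑ʳ }
  where
  cover : ∀ i → Image (↑ˡ-↣ _) i ⊎ Image (↑ʳ-↣ m) i
  cover i with splitView m i
  ... | inl a = inj₁ (a , refl)
  ... | inr b = inj₂ (b , refl)

↑ʳ-complementary : {A : Fin a ↣ Fin n} {B : Fin b ↣ Fin n} → Complementary A B →
                   Complementary (↑ʳ-↣ m ↣-∘ A) (↣-id (Fin m) ⊕↣ B)
↑ʳ-complementary {n = n} {b = b} {m = m} {A} {B} A∁B = record { cover = cover ; disjoint = disjoint }
  where
  open Complementary A∁B renaming (cover to coverₙ; disjoint to disjointₙ)
  id⊕B : Fin (m + b) ↣ Fin (m + n)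
  id⊕B = ↣-id (Fin m) ⊕↣ B

  cover : ∀ i → Image (↑ʳ-↣ m ↣-∘ A) i ⊎ Image id⊕B i
  cover i with splitView m i
  ... | inl c = inj₂ (c ↑ˡ _ , ⊕-↑ˡ (to (↣-id (Fin m))) (to B) c)
  ... | inr c with coverₙ c
  ...   | inj₁ (i′ , refl) = inj₁ (i′ , refl)
  ...   | inj₂ (j′ , refl) = inj₂ (m ↑ʳ j′ , ⊕-↑ʳ (to (↣-id (Fin m))) (to B) j′)

  disjoint : ∀ i j → m ↑ʳ to A i ≢ to id⊕B j
  disjoint i j eq with splitView m j
  ... | inl c = ↑ˡ≢↑ʳ _ _ (sym (trans eq (⊕-↑ˡ (to (↣-id (Fin m))) (to B) c)))
  ... | inr c = disjointₙ i c (↑ʳ-injective m _ _ (trans eq (⊕-↑ʳ (to (↣-id (Fin m))) (to B) c)))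

sameImage-complement : (τ : Fin m ↣ Fin n) → Onto τ →
                       {A : Fin a ↣ Fin m} {B : Fin b ↣ Fin m} → Complementary A B →
                       {A′ : Fin k ↣ Fin n} {B′ : Fin l ↣ Fin n} → Complementary A′ B′ →
                       SameImage (τ ↣-∘ A) A′ → SameImage (τ ↣-∘ B) B′
sameImage-complement τ τ-onto {A} {B} A∁B {A′} {B′} A′∁B′ (τA⊆A′ , A′⊆τA) = τB⊆B′ , B′⊆τB
  where
  open Complementary
  τB⊆B′ : (τ ↣-∘ B) ⊆ B′
  τB⊆B′ .⊆-at j with cover A′∁B′ (to τ (to B j))
  ... | inj₂ B′∋τBj = B′∋τBj
  ... | inj₁ (i , A′i≡τBj) with ⊆-at A′⊆τA i
  ...   | i′ , τAi′≡A′i = ⊥-elim (disjoint A∁B i′ j (injective τ (trans τAi′≡A′i A′i≡τBj)))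

  B′⊆τB : B′ ⊆ (τ ↣-∘ B)
  B′⊆τB .⊆-at j with τ-onto (to B′ j)
  ... | z , τz≡B′j with cover A∁B z
  ...   | inj₂ (i , refl) = i , τz≡B′j
  ...   | inj₁ (i , refl) with ⊆-at τA⊆A′ i
  ...     | i′ , A′i′≡τAi = ⊥-elim (disjoint A′∁B′ i′ j (trans A′i′≡τAi τz≡B′j))

module UniqueFactorisation (h : AssocPresheaf) (connected : Connected h) where
  open AssocPresheaf h
  open Coinvariants h

  size : Obj → ℕ
  size = proj₁

  object : (o : Obj) → H (size o)
  object = proj₂

  res-↣-id : (x : H n) → res (↣-id (Fin n)) x ≡ x
  res-↣-id = res-id (↣-id _) (λ _ → refl)

  res-↣-∘ : (f : Fin k ↣ Fin m) (g : Fin m ↣ Fin n) (x : H n) → res (g ↣-∘ f) x ≡ res f (res g x)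
  res-↣-∘ f g = res-∘ f g (g ↣-∘ f) (λ _ → refl)

  ≡⇒≃ : ∀ {o o′} → o ≡ o′ → o ≃ o′
  ≡⇒≃ {n , _} refl = ↣-id (Fin n) , (λ j → j , refl) , res-↣-id _

  ≃-refl : ∀ {o} → o ≃ o
  ≃-refl = ≡⇒≃ refl

  ≃-sym : ∀ {o o′} → o ≃ o′ → o′ ≃ o
  ≃-sym {_ , x} {_ , y} (σ , onto , σx≡y) = σ⁻¹ , (λ i → to σ i , inverseˡ σ onto i) , (begin
    res σ⁻¹ y             ≡⟨ cong (res σ⁻¹) σx≡y ⟨
    res σ⁻¹ (res σ x)     ≡⟨ res-↣-∘ σ⁻¹ σ x ⟨
    res (σ ↣-∘ σ⁻¹) x     ≡⟨ res-id _ (inverseʳ σ onto) x ⟩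
    x                     ∎)
    where
    open ≡-Reasoning
    σ⁻¹ = inverse σ onto

  ≃-trans : ∀ {o o′ o″} → o ≃ o′ → o′ ≃ o″ → o ≃ o″
  ≃-trans {_ , x} (σ , σ-onto , refl) (τ , τ-onto , refl) =
    σ ↣-∘ τ , ∘-onto σ τ σ-onto τ-onto , res-↣-∘ τ σ x

  ≃-setoid : Setoid _ _
  ≃-setoid = record
    { Carrier = Obj ; _≈_ = _≃_
    ; isEquivalence = record { refl = ≃-refl ; sym = ≃-sym ; trans = ≃-trans } }

  open Permutation ≃-setoid using (_↭_; prep; ↭-refl; ↭-trans; ↭-prep; ↭-swap)

  sameImage⇒res-≃ : {e : Fin k ↣ Fin n} {e′ : Fin l ↣ Fin n} → SameImage e e′ →
                    (x : H n) → (k , res e x) ≃ (l , res e′ x)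
  sameImage⇒res-≃ {k} {n} {l} {e} {e′} (e⊆e′ , e′⊆e) x = σ , σ-onto , sym (res-∘ σ e e′ (sym ∘ e-σ) x)
    where
    σ : Fin l ↣ Fin k
    σ = mk↣ {to = proj₁ ∘ ⊆-at e′⊆e} (λ {i} {j} eq →
          injective e′ (trans (sym (proj₂ (⊆-at e′⊆e i))) (trans (cong (to e) eq) (proj₂ (⊆-at e′⊆e j)))))
    e-σ : ∀ j → to e (to σ j) ≡ to e′ j
    e-σ j = proj₂ (⊆-at e′⊆e j)
    σ-onto : Onto σ
    σ-onto i with ⊆-at e⊆e′ i
    ... | j , e′j≡ei = j , injective e (trans (e-σ j) e′j≡ei)

  res-↑ʳ-∗ : (u : H m) (v : H n) → res (↑ʳ-↣ m) (u ∗ v) ≡ v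
  res-↑ʳ-∗ {m} u v = begin
    res (↑ʳ-↣ m) (u ∗ v)                   ≡⟨ res-∗ empty-↣ (↣-id _) (↑ʳ-↣ m) (λ _ → refl) u v ⟩
    res empty-↣ u ∗ res (↣-id _) v         ≡⟨ cong₂ _∗_ (connected _) (res-↣-id v) ⟩
    one ∗ v                                ≡⟨ ∗-unitˡ v ⟩
    v                                      ∎
    where open ≡-Reasoning

  private
    res-cast : (eq : m ≡ n) (c : Fin n ↣ Fin m) → (∀ i → toℕ (to c i) ≡ toℕ i) →
               (x : H m) → _≡_ {A = Obj} (m , x) (n , res c x)
    res-cast refl c c≗id x = cong (_ ,_) (sym (res-id c (toℕ-injective ∘ c≗id) x))

    subst-H : (eq : m ≡ n) (x : H m) → _≡_ {A = Obj} (m , x) (n , subst H eq x)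
    subst-H refl x = refl

  -- m + 0 is not m definitionally, so the right unit law forces a detour through a cast.
  res-↑ˡ-∗ : (u : H m) (v : H n) → _≡_ {A = Obj} (m , res (↑ˡ-↣ n) (u ∗ v)) (m , u)
  res-↑ˡ-∗ {m} {n} u v = begin
    m , res (↑ˡ-↣ n) (u ∗ v)
      ≡⟨ res-cast (sym (+-identityʳ m)) c (toℕ-cast _) _ ⟩
    m + 0 , res c (res (↑ˡ-↣ n) (u ∗ v))
      ≡⟨ cong (m + 0 ,_) (res-↣-∘ c (↑ˡ-↣ n) (u ∗ v)) ⟨
    m + 0 , res (↑ˡ-↣ n ↣-∘ c) (u ∗ v)
      ≡⟨ cong (m + 0 ,_) (res-∗ (↣-id _) empty-↣ _ ↑ˡc≗id⊕empty u v) ⟩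
    m + 0 , res (↣-id _) u ∗ res empty-↣ v
      ≡⟨ cong (m + 0 ,_) (cong₂ _∗_ (res-↣-id u) (connected _)) ⟩
    m + 0 , u ∗ one
      ≡⟨ subst-H (+-identityʳ m) (u ∗ one) ⟩
    m , subst H (+-identityʳ m) (u ∗ one)
      ≡⟨ cong (m ,_) (∗-unitʳ u) ⟩
    m , u ∎
    where
    open ≡-Reasoning
    c : Fin (m + 0) ↣ Fin m
    c = mk↣ {to = cast (+-identityʳ m)} (λ {i} {j} eq →
          toℕ-injective (trans (sym (toℕ-cast _ i)) (trans (cong toℕ eq) (toℕ-cast _ j))))
    ↑ˡc≗id⊕empty : ∀ i → to (↑ˡ-↣ n ↣-∘ c) i ≡ (to (↣-id (Fin m)) ⊕ to (empty-↣ {n})) i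
    ↑ˡc≗id⊕empty i with splitView m i
    ... | inl a = trans (cong (_↑ˡ n) (toℕ-injective (trans (toℕ-cast _ (a ↑ˡ 0)) (toℕ-↑ˡ a 0))))
                        (sym (⊕-↑ˡ (to (↣-id (Fin m))) (to (empty-↣ {n})) a))

  ≃𝟙⇒empty : {x : H k} → (k , x) ≃ 𝟙 → ¬ Fin k
  ≃𝟙⇒empty (_ , onto , _) i with onto i
  ... | () , _

  ∗-emptyˡ : (u : H k) (v : H l) → ¬ Fin k → _≡_ {A = Obj} (k + l , u ∗ v) (l , v)
  ∗-emptyˡ {zero} u v _ = cong (_ ,_) (trans (cong (_∗ v) (connected u)) (∗-unitˡ v))
  ∗-emptyˡ {suc k} u v ¬Fin-k = ⊥-elim (¬Fin-k zero)

  irreducible-nonempty : ∀ {x} → Irreducible x → Fin (size x)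
  irreducible-nonempty {zero , x} (x≄𝟙 , _) = ⊥-elim (x≄𝟙 (≡⇒≃ (cong (0 ,_) (connected x))))
  irreducible-nonempty {suc m , _} _ = zero

  ≃-point : ∀ {o o′} → o ≃ o′ → Fin (size o) → Fin (size o′)
  ≃-point (_ , onto , _) i = proj₁ (onto i)

  res-∗-split : ∀ {k m n} (e : Fin k ↣ Fin (m + n)) (u : H m) (v : H n) →
                let open ImageSplit (splitImage {p = m} {q = n} e) in
                (k , res e (u ∗ v)) ≃ ((k₁ , res left u) · (k₂ , res right v))
  res-∗-split {m = m} {n} e u v = ≃-trans (sameImage⇒res-≃ sameImage (u ∗ v))
                              (≡⇒≃ (cong (_ ,_) (res-∗ left right (left ⊕↣ right) (λ _ → refl) u v)))
    where open ImageSplit (splitImage {p = m} {q = n} e)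

  irreducible-in-factor : ∀ {x} → Irreducible x → {u : H m} {v : H n} (e : Fin k ↣ Fin (m + n)) →
                          x ≃ (k , res e (u ∗ v)) →
                          e ⊆ ↑ˡ-↣ n ⊎ Σ ℕ λ l → Σ (Fin l ↣ Fin n) λ g →
                                        x ≃ (l , res g v) × e ⊆ (↑ʳ-↣ m ↣-∘ g)
  irreducible-in-factor {m} {n} {x = x} (_ , split) {u} {v} e x≃ =
    [ inj₂ ∘ left-trivial , inj₁ ∘ right-trivial ]′ (split _ _ x≃left·right)
    where
    open ImageSplit (splitImage {p = m} {q = n} e)
    x≃left·right : x ≃ ((k₁ , res left u) · (k₂ , res right v))
    x≃left·right = ≃-trans x≃ (res-∗-split e u v)

    left-trivial : (k₁ , res left u) ≃ 𝟙 →
                   Σ ℕ λ l → Σ (Fin l ↣ Fin n) λ g → x ≃ (l , res g v) × e ⊆ (↑ʳ-↣ m ↣-∘ g)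
    left-trivial left≃𝟙 = k₂ , right , ≃-trans x≃left·right (≡⇒≃ (∗-emptyˡ _ _ (≃𝟙⇒empty left≃𝟙))) ,
                          ⊆-trans (proj₁ sameImage) left⊕right⊆↑ʳright
      where
      left⊕right⊆↑ʳright : (left ⊕↣ right) ⊆ (↑ʳ-↣ m ↣-∘ right)
      left⊕right⊆↑ʳright .⊆-at i with splitView k₁ i
      ... | inl a = ⊥-elim (≃𝟙⇒empty left≃𝟙 a)
      ... | inr b = b , sym (⊕-↑ʳ (to left) (to right) b)

    right-trivial : (k₂ , res right v) ≃ 𝟙 → e ⊆ ↑ˡ-↣ n
    right-trivial right≃𝟙 = ⊆-trans (proj₁ sameImage) left⊕right⊆↑ˡ
      where
      left⊕right⊆↑ˡ : (left ⊕↣ right) ⊆ ↑ˡ-↣ n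
      left⊕right⊆↑ˡ .⊆-at i with splitView k₁ i
      ... | inl a = to left a , sym (⊕-↑ˡ (to left) (to right) a)
      ... | inr b = ⊥-elim (≃𝟙⇒empty right≃𝟙 b)

  block : (ss : List Obj) (j : Fin (length ss)) → Fin (size (lookup ss j)) ↣ Fin (size (prod ss))
  block (s ∷ ss) zero    = ↑ˡ-↣ (size (prod ss))
  block (s ∷ ss) (suc j) = ↑ʳ-↣ (size s) ↣-∘ block ss j

  coblock : (ss : List Obj) (j : Fin (length ss)) → Fin (size (prod (removeAt ss j))) ↣ Fin (size (prod ss))
  coblock (s ∷ ss) zero    = ↑ʳ-↣ (size s)
  coblock (s ∷ ss) (suc j) = ↣-id (Fin (size s)) ⊕↣ coblock ss j

  block-complementary : ∀ ss j → Complementary (block ss j) (coblock ss j)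
  block-complementary (s ∷ ss) zero    = ↑-complementary
  block-complementary (s ∷ ss) (suc j) = ↑ʳ-complementary (block-complementary ss j)

  res-block : ∀ ss j → (size (lookup ss j) , res (block ss j) (object (prod ss))) ≡ lookup ss j
  res-block (s ∷ ss) zero    = res-↑ˡ-∗ (object s) (object (prod ss))
  res-block (s ∷ ss) (suc j) = begin
    _ , res (↑ʳ-↣ (size s) ↣-∘ block ss j) (object s ∗ object (prod ss))
      ≡⟨ cong (_ ,_) (res-↣-∘ (block ss j) (↑ʳ-↣ (size s)) _) ⟩
    _ , res (block ss j) (res (↑ʳ-↣ (size s)) (object s ∗ object (prod ss)))
      ≡⟨ cong (λ y → _ , res (block ss j) y) (res-↑ʳ-∗ (object s) (object (prod ss))) ⟩
    _ , res (block ss j) (object (prod ss))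
      ≡⟨ res-block ss j ⟩
    lookup ss j ∎
    where open ≡-Reasoning

  res-coblock : ∀ ss j → res (coblock ss j) (object (prod ss)) ≡ object (prod (removeAt ss j))
  res-coblock (s ∷ ss) zero    = res-↑ʳ-∗ (object s) (object (prod ss))
  res-coblock (s ∷ ss) (suc j) =
    trans (res-∗ (↣-id _) (coblock ss j) _ (λ _ → refl) (object s) (object (prod ss)))
          (cong₂ _∗_ (res-↣-id (object s)) (res-coblock ss j))

  irreducible-in-block : ∀ ss {x} → Irreducible x → (e : Fin k ↣ Fin (size (prod ss))) →
                         x ≃ (k , res e (object (prod ss))) → ∃ λ j → e ⊆ block ss j
  irreducible-in-block [] x-irr e x≃ with to e (≃-point x≃ (irreducible-nonempty x-irr))
  ... | ()
  irreducible-in-block (s ∷ ss) x-irr e x≃ with irreducible-in-factor x-irr e x≃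
  ... | inj₁ e⊆↑ˡ = zero , e⊆↑ˡ
  ... | inj₂ (_ , g , x≃g , e⊆↑ʳg) with irreducible-in-block ss x-irr g x≃g
  ...   | j , g⊆block = suc j , ⊆-trans e⊆↑ʳg (∘-monoʳ-⊆ (↑ʳ-↣ (size s)) g⊆block)

  factor-≃-res-block : ∀ {o} ts j (o≃ : o ≃ prod ts) →
                       lookup ts j ≃ (_ , res (proj₁ o≃ ↣-∘ block ts j) (object o))
  factor-≃-res-block {o} ts j (τ , _ , τ-eq) = ≡⇒≃ (sym (begin
    _ , res (τ ↣-∘ block ts j) (object o)      ≡⟨ cong (_ ,_) (res-↣-∘ (block ts j) τ (object o)) ⟩
    _ , res (block ts j) (res τ (object o))    ≡⟨ cong (λ y → _ , res (block ts j) y) τ-eq ⟩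
    _ , res (block ts j) (object (prod ts))    ≡⟨ res-block ts j ⟩
    lookup ts j                                ∎))
    where open ≡-Reasoning

  -- Implicit objects and lists are passed explicitly below: _≃_ and prod compute, so they are not
  -- recoverable by unification (and the attempt is very expensive).
  first-factor-block : ∀ {x xs ss} → Irreducible x → All Irreducible ss → (τ≃ : prod ss ≃ prod (x ∷ xs)) →
                       ∃ λ j → SameImage (proj₁ τ≃ ↣-∘ ↑ˡ-↣ (size (prod xs))) (block ss j)
  first-factor-block {x} {xs} {ss} x-irr ss-irr τ≃@(τ , τ-onto , _)
    with irreducible-in-block ss x-irr (τ ↣-∘ ↑ˡ-↣ _) (factor-≃-res-block {prod ss} (x ∷ xs) zero τ≃)
  ... | j , τ↑ˡ⊆block
    with irreducible-in-factor (All.lookup ss-irr (∈-lookup j)) (inverse τ τ-onto ↣-∘ block ss j)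
                               (factor-≃-res-block {prod (x ∷ xs)} ss j (≃-sym τ≃))
  ...   | inj₁ τ⁻¹block⊆↑ˡ = j , τ↑ˡ⊆block , inverse-⊆ τ τ-onto τ⁻¹block⊆↑ˡ
  ...   | inj₂ (_ , g , _ , τ⁻¹block⊆↑ʳg)
    with ⊆-at (⊆-via-inverse τ τ-onto {A = ↑ˡ-↣ (size (prod xs))} τ↑ˡ⊆block τ⁻¹block⊆↑ʳg)
              (irreducible-nonempty x-irr)
  ...     | _ , ↑ʳg≡↑ˡ = ⊥-elim (↑ˡ≢↑ʳ _ _ (sym ↑ʳg≡↑ˡ))

  sameImage-block⇒factor-≃ : ∀ {x xs ss} (τ≃ : prod ss ≃ prod (x ∷ xs)) j →
                             SameImage (proj₁ τ≃ ↣-∘ ↑ˡ-↣ (size (prod xs))) (block ss j) →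
                             x ≃ lookup ss j × prod (removeAt ss j) ≃ prod xs
  sameImage-block⇒factor-≃ {x} {xs} {ss} τ≃@(τ , τ-onto , τ-eq) j τ↑ˡ≈block = x≃sⱼ , rest≃xs
    where
    P : H (size (prod ss))
    P = object (prod ss)

    τ↑ʳ≈coblock : SameImage (τ ↣-∘ ↑ʳ-↣ (size x)) (coblock ss j)
    τ↑ʳ≈coblock = sameImage-complement τ τ-onto ↑-complementary (block-complementary ss j) τ↑ˡ≈block

    τ↑ʳ[P]≡xs : res (τ ↣-∘ ↑ʳ-↣ (size x)) P ≡ object (prod xs)
    τ↑ʳ[P]≡xs = begin
      res (τ ↣-∘ ↑ʳ-↣ (size x)) P                        ≡⟨ res-↣-∘ (↑ʳ-↣ (size x)) τ P ⟩
      res (↑ʳ-↣ (size x)) (res τ P)                       ≡⟨ cong (res (↑ʳ-↣ (size x))) τ-eq ⟩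
      res (↑ʳ-↣ (size x)) (object x ∗ object (prod xs))   ≡⟨ res-↑ʳ-∗ (object x) (object (prod xs)) ⟩
      object (prod xs)                                    ∎
      where open ≡-Reasoning

    x≃sⱼ : x ≃ lookup ss j
    x≃sⱼ = begin
      x                                                    ≈⟨ factor-≃-res-block {prod ss} (x ∷ xs) zero τ≃ ⟩
      (size x , res (τ ↣-∘ ↑ˡ-↣ (size (prod xs))) P)       ≈⟨ sameImage⇒res-≃ τ↑ˡ≈block P ⟩
      (size (lookup ss j) , res (block ss j) P)            ≡⟨ res-block ss j ⟩
      lookup ss j                                          ∎
      where open SetoidReasoning ≃-setoid

    rest≃xs : prod (removeAt ss j) ≃ prod xs
    rest≃xs = begin
      prod (removeAt ss j)                                 ≡⟨ cong (_ ,_) (res-coblock ss j) ⟨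
      (size (prod (removeAt ss j)) , res (coblock ss j) P) ≈⟨ sameImage⇒res-≃ (swap τ↑ʳ≈coblock) P ⟩
      (size (prod xs) , res (τ ↣-∘ ↑ʳ-↣ (size x)) P)       ≡⟨ cong (_ ,_) τ↑ʳ[P]≡xs ⟩
      prod xs                                              ∎
      where open SetoidReasoning ≃-setoid

  cancel-first-factor : ∀ {x xs ss} → Irreducible x → All Irreducible ss → prod ss ≃ prod (x ∷ xs) →
                        ∃ λ j → x ≃ lookup ss j × prod (removeAt ss j) ≃ prod xs
  cancel-first-factor {x} {xs} {ss} x-irr ss-irr τ≃ =
    map₂ (λ {j} → sameImage-block⇒factor-≃ {x} {xs} {ss} τ≃ j)
         (first-factor-block {x} {xs} {ss} x-irr ss-irr τ≃)

  ∷-↭-removeAt : ∀ {x xs} ss j → x ≃ lookup ss j → xs ↭ removeAt ss j → x ∷ xs ↭ ss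
  ∷-↭-removeAt (s ∷ ss) zero    x≃s xs↭ss = prep x≃s xs↭ss
  ∷-↭-removeAt {x} (s ∷ ss) (suc j) x≃sⱼ xs↭s∷ss′ =
    ↭-trans (↭-prep x xs↭s∷ss′) (↭-trans (↭-swap x s ↭-refl) (↭-prep s (∷-↭-removeAt ss j x≃sⱼ ↭-refl)))

  factorisations-↭ : ∀ {xs ss} → All Irreducible xs → All Irreducible ss → prod ss ≃ prod xs → xs ↭ ss
  factorisations-↭ {[]} {[]} _ _ _ = ↭-refl
  factorisations-↭ {[]} {s ∷ ss} _ (s-irr ∷ _) ss≃𝟙 =
    ⊥-elim (≃𝟙⇒empty ss≃𝟙 (irreducible-nonempty s-irr ↑ˡ size (prod ss)))
  factorisations-↭ {x ∷ xs} {ss} (x-irr ∷ xs-irr) ss-irr ss≃ =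
    cancel (cancel-first-factor {x} {xs} {ss} x-irr ss-irr ss≃)
    where
    cancel : (∃ λ j → x ≃ lookup ss j × prod (removeAt ss j) ≃ prod xs) → x ∷ xs ↭ ss
    cancel (j , x≃sⱼ , rest≃xs) =
      ∷-↭-removeAt {x} {xs} ss j x≃sⱼ
        (factorisations-↭ {xs} {removeAt ss j} xs-irr (All-removeAt ss j ss-irr) rest≃xs)

mainTheorem9 : (h : AssocPresheaf) → Connected h →
    let open Coinvariants h in
    (a : Obj) (xs ss : List Obj) →
    All Irreducible xs → All Irreducible ss →
    a ≃ prod xs → a ≃ prod ss →
    SameMultiset xs ss
mainTheorem9 h connected a xs ss xs-irr ss-irr a≃xs a≃ss =
  factorisations-↭ {xs} {ss} xs-irr ss-irr (≃-trans {prod ss} {a} {prod xs} (≃-sym {a} {prod ss} a≃ss) a≃xs)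
  where
  open Coinvariants h using (prod)
  open UniqueFactorisation h connected
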